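{- The sets of graphs $M(k)$, $k\in\mathbf{N}$, have the following properties. 1. For every $k$, $M(3k+1)\subset B(k,G_1)$. In particular, $M(31)\subset B({5\choose 2},G_1)$. 2. For every $k$, $\mathrm{gex}(M(k),n)\ll n\log n$.
   Context: Graphs are finite lists of two-element subsets (edges) of $\mathbf{N}=\{1,2,\dots\}$, with vertex set the union of the edges (ordered by the natural order of $\mathbf{N}$). A graph $H$ contains $H'$, written $H\succ H'$ (equivalently $H'\prec H$), if there exist an increasing injection $F$ from the vertices of $H'$ to the vertices of $H$ and an injection $f$ from the edges of $H'$ to the edges of $H$ such that $v\in E'$ implies $F(v)\in f(E')$ for every vertex $v$ and edge $E'$ of $H'$; the image is called an $H'$-copy in $H$. For a family $R$ of simple graphs, $\mathrm{gex}(R,n)$ is the maximum number of edges of a simple graph $G$ with at most $n$ vertices such that $G\not\succ G'$ for all $G'\in R$. Let $G_1=(\{1,3\},\{1,5\},\{2,3\},\{2,4\})$. For $k\in\mathbf{N}$, a simple graph $G'$ is a $k$-blow-up of a simple graph $G$ if for every edge coloring $\chi:G'\to\mathbf{N}$ using every color at most $k$ times there is a $G$-copy in $G'$ on which $\chi$ is injective; $B(k,G)$ denotes the set of all $k$-blow-ups of $G$. A simple graph $G$ is a $k$-multiple of $G_1$ if its vertex set is $A\cup\{v\}\cup B\cup C$ with $A<v<B<C$ (every element of the earlier set smaller than every element of the later one), $|A|=k$, the vertex $v$ has degree $k$ and is joined to every vertex of $A$, every vertex of $A$ has degree $2k+1$ and besides $v$ is joined to $k$ vertices in $B$ and $k$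 vertices in $C$, and there are no other edges. $M(k)$ denotes the set of all $k$-multiples of $G_1$. The notation $f\ll g$ means $|f(n)|<c|g(n)|$ for all $n>n_0$ with a constant $c>0$. -}

module Defs where

open import Data.Nat using (ℕ; zero; suc; _+_; _*_; _≤_; _<_; z≤n; s≤s; _≡ᵇ_)
open import Data.Nat.Properties using (_≟_)
open import Data.Nat.Logarithm using (⌊log₂_⌋)
open import Data.Bool using (Bool; _∧_; _∨_)
open import Data.Bool.ListAction using (any)
open import Data.Fin using (Fin)
open import Data.List using (List; []; _∷_; length; lookup; map; concatMap; filterᵇ; deduplicate; allFin)
open import Data.List.Membership.Propositional using (_∈_)
open import Data.List.Relation.Unary.Unique.Propositional using (Unique)
open import Data.Product using (_×_; _,_; Σ; ∃; ∃-syntax)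
open import Data.Sum using (_⊎_)
open import Relation.Binary.PropositionalEquality using (_≡_; _≢_)
open import Relation.Nullary using (¬_)

-- An edge is a two-element subset {lo, hi} of N = {1,2,...}, stored with lo < hi.
record Edge : Set where
  constructor mkEdge
  field
    lo  : ℕ
    hi  : ℕ
    pos : 1 ≤ lo
    ord : lo < hi
open Edge public

-- A graph is a finite list of edges (repetitions allowed).
Graph : Set
Graph = List Edge

endpoints : Edge → ℕ × ℕ
endpoints e = lo e , hi e

Simple : Graph → Set
Simple G = Unique (map endpoints G)

_∈ₑ_ : ℕ → Edge → Set
v ∈ₑ e = (v ≡ lo e) ⊎ (v ≡ hi e)

_∈V_ : ℕ → Graph → Set
v ∈V G = Σ Edge λ e → (e ∈ G) × (v ∈ₑ e)

vertexList : Graph → List ℕ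
vertexList = concatMap (λ e → lo e ∷ hi e ∷ [])

numVertices : Graph → ℕ
numVertices G = length (deduplicate _≟_ (vertexList G))

-- H' ≺ H : an H'-copy in H given by (F , f)
record Embedding (H' H : Graph) : Set where
  field
    F      : ℕ → ℕ
    f      : Fin (length H') → Fin (length H)
    F-vert : ∀ v → v ∈V H' → F v ∈V H
    F-incr : ∀ u v → u ∈V H' → v ∈V H' → u < v → F u < F v
    f-inj  : ∀ i j → f i ≡ f j → i ≡ j
    incid  : ∀ (i : Fin (length H')) v → v ∈ₑ lookup H' i → F v ∈ₑ lookup H (f i)
open Embedding public

_≻_ : Graph → Graph → Set
H ≻ H' = Embedding H' H

G₁ : Graph
G₁ = mkEdge 1 3 (s≤s z≤n) (s≤s (s≤s z≤n))
   ∷ mkEdge 1 5 (s≤s z≤n) (s≤s (s≤s z≤n))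
   ∷ mkEdge 2 3 (s≤s z≤n) (s≤s (s≤s (s≤s z≤n)))
   ∷ mkEdge 2 4 (s≤s z≤n) (s≤s (s≤s (s≤s z≤n)))
   ∷ []

colourCount : (G' : Graph) → (Fin (length G') → ℕ) → ℕ → ℕ
colourCount G' χ c = length (filterᵇ (λ i → χ i ≡ᵇ c) (allFin (length G')))

-- G' ∈ B(k, G): G' simple and k-blow-up of G
InBlowUp : ℕ → Graph → Graph → Set
InBlowUp k G G' =
  Simple G' ×
  ((χ : Fin (length G') → ℕ) → (∀ c → colourCount G' χ c ≤ k) →
     Σ (Embedding G G') λ emb → ∀ i j → χ (f emb i) ≡ χ (f emb j) → i ≡ j)

edgeIsᵇ : ℕ → ℕ → Edge → Bool
edgeIsᵇ u w e = ((lo e ≡ᵇ u) ∧ (hi e ≡ᵇ w)) ∨ ((lo e ≡ᵇ w) ∧ (hi e ≡ᵇ u))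

adjᵇ : Graph → ℕ → ℕ → Bool
adjᵇ G u w = any (edgeIsᵇ u w) G

incidentᵇ : ℕ → Edge → Bool
incidentᵇ u e = (lo e ≡ᵇ u) ∨ (hi e ≡ᵇ u)

degree : Graph → ℕ → ℕ
degree G u = length (filterᵇ (incidentᵇ u) G)

nbrsIn : Graph → ℕ → List ℕ → ℕ
nbrsIn G u S = length (filterᵇ (adjᵇ G u) S)

Adj : Graph → ℕ → ℕ → Set
Adj G u w = Σ Edge λ e → (e ∈ G) × (((lo e ≡ u) × (hi e ≡ w)) ⊎ ((lo e ≡ w) × (hi e ≡ u)))

-- G ∈ M(k): G is a k-multiple of G₁
record Multiple (k : ℕ) (G : Graph) : Set where
  field
    simple  : Simple G
    A B C   : List ℕ
    v       : ℕ
    uniqA   : Unique A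
    uniqB   : Unique B
    uniqC   : Unique C
    vset    : ∀ u → u ∈V G → (u ∈ A) ⊎ (u ≡ v) ⊎ (u ∈ B) ⊎ (u ∈ C)
    vset⁻   : ∀ u → (u ∈ A) ⊎ (u ≡ v) ⊎ (u ∈ B) ⊎ (u ∈ C) → u ∈V G
    A<v     : ∀ a → a ∈ A → a < v
    v<B     : ∀ b → b ∈ B → v < b
    B<C     : ∀ b c → b ∈ B → c ∈ C → b < c
    sizeA   : length A ≡ k
    deg-v   : degree G v ≡ k
    v-A     : ∀ a → a ∈ A → Adj G v a
    deg-A   : ∀ a → a ∈ A → degree G a ≡ suc (k + k)
    A-B     : ∀ a → a ∈ A → nbrsIn G a B ≡ k
    A-C     : ∀ a → a ∈ A → nbrsIn G a C ≡ k
    noOther : ∀ e → e ∈ G →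
              (lo e ∈ A × hi e ≡ v) ⊎ (lo e ∈ A × hi e ∈ B) ⊎ (lo e ∈ A × hi e ∈ C)
open Multiple public

AvoidsM : ℕ → Graph → Set
AvoidsM k G = ∀ G' → Multiple k G' → ¬ (G ≻ G')

-- gex(M(k), n) ≪ n log n :
-- ∃ c n₀, ∀ n > n₀, every simple G with ≤ n vertices avoiding M(k) has < c·n·log₂ n edges
GexNLogN : ℕ → Set
GexNLogN k = ∃[ c ] ∃[ n₀ ] (∀ n → n₀ < n → ∀ G → Simple G → numVertices G ≤ n →
               AvoidsM k G → length G < c * n * ⌊log₂ n ⌋)

-- Part 1. Colour a (3k+1)-multiple of G₁ using every colour at most k times. Among the 3k+1
-- edges at v two, a₁v and a₂v with a₁ < a₂, have different colours; of the 3k+1 edges from a₂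
-- into B one, a₂y, avoids both colours, and of the 3k+1 edges from a₁ into C one, a₁z, avoids
-- all three. Then a₁ < a₂ < v < y < z carry a rainbow copy of G₁.
--
-- Part 2. Rank the vertices 1, …, n and call u a right neighbour of a if au is an edge with
-- a < u. Label an edge aw (a < w) by ‘final a’ if fewer than k right neighbours of a lie beyond
-- w. Otherwise let R be the largest rank such that a has k right neighbours of rank above R, let
-- l be the dyadic level with rank w in the window (⌊R/2^(l+1)⌋ 2^(l+1), ⌊R/2^l⌋ 2^l], and let
-- the threshold T be ⌊R/2^l⌋ 2^l. Label aw by ‘sparse a l’ if fewer than k right neighbours of
-- a lie in (w, T] (by rank), and by ‘dense w l’ otherwise. Every label carries at most k edges:
-- for the first two kinds a and T are fixed and the number of right neighbours beyond w
-- (resp. in (w, T]) separates the edges; for the third, T is the least multiple of 2^l that is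
-- at least rank w, so k edges labelled ‘dense w l’ give k vertices a joined to w, each with k
-- right neighbours in (w, T] and k of rank above T, i.e. a k-multiple of G₁. As 2^l ≤ R ≤ n,
-- there are at most n + 2n(⌊log₂ n⌋ + 1) labels.

module Submission where

open import Defs
open import Data.Nat using (ℕ; suc; _*_; _+_; _≤_)
open import Data.Product using (_×_)
open import Data.Bool using (T)
open import Data.Bool.Properties using (T-∧; T-∨; T?)
open import Data.Empty using (⊥-elim)
open import Data.Fin using (Fin; zero; suc; toℕ; fromℕ<)
open import Data.Fin.Properties using (injective⇒≤; toℕ-fromℕ<)
open import Data.List using (List; []; _∷_; length; map; filter; filterᵇ; lookup; allFin; concatMap; take; deduplicate; upTo; _++_)
open import Data.List.Membership.Propositional using (_∈_; _∉_; find)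
open import Data.List.Membership.Propositional.Properties using (∈-lookup; ∈-map⁺; ∈-map⁻; ∈-filter⁺; ∈-filter⁻; ∈-concatMap⁺; ∈-concatMap⁻; ∈-deduplicate⁺; ∈-deduplicate⁻; ∈-++⁺ˡ; ∈-++⁺ʳ; ∈-++⁻; ∈-allFin; ∈-upTo⁺)
open import Data.List.Properties using (length-map; length-++; length-take; length-upTo; length-filter; filter-some; map-id)
open import Data.List.Relation.Binary.Subset.Propositional using (_⊆_)
import Data.List.Relation.Binary.Sublist.Propositional as Sublist
import Data.List.Relation.Binary.Sublist.Propositional.Properties as Sublistₚ
open import Data.List.Relation.Unary.All as All using (All; []; _∷_)
open import Data.List.Relation.Unary.All.Properties using (¬All⇒Any¬) renaming (map⁺ to All-map⁺)
open import Data.List.Relation.Unary.Any as Any using (here; there; index)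
open import Data.List.Relation.Unary.Any.Properties using (any⁺; any⁻; lookup-index)
open import Data.List.Relation.Unary.Unique.Propositional using (Unique; []; _∷_)
open import Data.List.Relation.Unary.Unique.Propositional.Properties using (filter⁺; map⁺; take⁺; ++⁺; allFin⁺)
open import Data.Nat using (zero; _∸_; _^_; _<_; z≤n; s≤s; _≤?_; _<?_; _≡ᵇ_; ⌊_/2⌋)
open import Data.Nat.Logarithm using (⌊log₂_⌋; ⌊log₂⌋-mono-≤; ⌊log₂[2^n]⌋≡n)
open import Data.Nat.Properties
open import Data.Nat.Solver using (module +-*-Solver)
open import Data.Product using (Σ; _,_; proj₁; proj₂; uncurry)
open import Data.Product.Properties using () renaming (≡-dec to ×-≡-dec)
open import Data.Sum using (_⊎_; inj₁; inj₂)
open import Data.Sum.Properties using () renaming (≡-dec to ⊎-≡-dec)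
open import Function using (_∘_; Equivalence)
open import Level using (0ℓ)
open import Relation.Binary.Definitions using (DecidableEquality; tri<; tri≈; tri>)
open import Relation.Binary.PropositionalEquality using (_≡_; _≢_; refl; sym; trans; cong; cong₂; subst; subst₂; module ≡-Reasoning)
open import Relation.Nullary using (¬_; Dec; yes; no; contradiction)
open import Relation.Nullary.Decidable using (_×-dec_)
open import Relation.Unary using (Pred; Decidable)
open import Data.List.Membership.DecPropositional _≟_ using (_∈?_)
open import Data.List.Membership.DecPropositional (×-≡-dec _≟_ _≟_) using () renaming (_∈?_ to _∈²?_)
open import Data.List.Relation.Unary.Unique.DecPropositional.Properties _≟_ using (deduplicate-!)

open +-*-Solver using (solve; _:+_; _:*_; _:=_; con)

private variable
  X Y Λ : Set

lookup-injective : ∀ (g : X → Y) {xs} → Unique (map g xs) →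
                   ∀ i j → g (lookup xs i) ≡ g (lookup xs j) → i ≡ j
lookup-injective g {_ ∷ _}  _          zero    zero    _  = refl
lookup-injective g {_ ∷ xs} (x∉ ∷ _)   zero    (suc j) eq =
  ⊥-elim (All.lookup x∉ (∈-map⁺ g (∈-lookup {xs = xs} j)) eq)
lookup-injective g {_ ∷ xs} (x∉ ∷ _)   (suc i) zero    eq =
  ⊥-elim (All.lookup x∉ (∈-map⁺ g (∈-lookup {xs = xs} i)) (sym eq))
lookup-injective g {_ ∷ _}  (_ ∷ uniq) (suc i) (suc j) eq = cong suc (lookup-injective g uniq i j eq)

Unique-lookup-injective : ∀ {xs : List X} → Unique xs → ∀ i j → lookup xs i ≡ lookup xs j → i ≡ j
Unique-lookup-injective {xs = xs} uniq = lookup-injective (λ x → x) (subst Unique (sym (map-id xs)) uniq)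

Unique-length-≤ : ∀ {xs ys : List X} → Unique xs → xs ⊆ ys → length xs ≤ length ys
Unique-length-≤ {xs = xs} {ys} uniq xs⊆ys = injective⇒≤ position-injective
  where
  position : Fin (length xs) → Fin (length ys)
  position i = index (xs⊆ys (∈-lookup {xs = xs} i))
  position-injective : ∀ {i j} → position i ≡ position j → i ≡ j
  position-injective {i} {j} eq = Unique-lookup-injective uniq i j (begin
    lookup xs i            ≡⟨ lookup-index (xs⊆ys (∈-lookup {xs = xs} i)) ⟩
    lookup ys (position i) ≡⟨ cong (lookup ys) eq ⟩
    lookup ys (position j) ≡⟨ sym (lookup-index (xs⊆ys (∈-lookup {xs = xs} j))) ⟩
    lookup xs j            ∎)
    where open ≡-Reasoning

pigeonhole : ∀ {xs : List X} (ψ : X → ℕ) {m} → Unique xs →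
             (∀ {x y} → x ∈ xs → y ∈ xs → ψ x ≡ ψ y → x ≡ y) →
             (∀ {x} → x ∈ xs → ψ x < m) → length xs ≤ m
pigeonhole {xs = xs} ψ uniq ψ-injective ψ-bounded = injective⇒≤ hole-injective
  where
  hole : Fin (length xs) → Fin _
  hole i = fromℕ< (ψ-bounded (∈-lookup {xs = xs} i))
  hole-injective : ∀ {i j} → hole i ≡ hole j → i ≡ j
  hole-injective {i} {j} eq = Unique-lookup-injective uniq i j
    (ψ-injective (∈-lookup {xs = xs} i) (∈-lookup {xs = xs} j)
      (trans (sym (toℕ-fromℕ< _)) (trans (cong toℕ eq) (toℕ-fromℕ< _))))

length-concatMap-≤ : ∀ (f : X → List Y) {m} (xs : List X) → (∀ x → length (f x) ≤ m) →
                     length (concatMap f xs) ≤ length xs * m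
length-concatMap-≤ f []       _     = z≤n
length-concatMap-≤ f (x ∷ xs) bound rewrite length-++ (f x) {concatMap f xs} =
  +-mono-≤ (bound x) (length-concatMap-≤ f xs bound)

module _ (_≟_ : DecidableEquality Λ) (φ : X → Λ) where

  fibre : List X → Λ → List X
  fibre xs l = filter (λ x → φ x ≟ l) xs

  length-≤-fibres : ∀ {xs} (labels : List Λ) {m} → Unique xs → (∀ {x} → x ∈ xs → φ x ∈ labels) →
                    (∀ l → length (fibre xs l) ≤ m) → length xs ≤ length labels * m
  length-≤-fibres {xs} labels uniq φ∈labels fibre-bound =
    ≤-trans (Unique-length-≤ uniq in-own-fibre) (length-concatMap-≤ (fibre xs) labels fibre-bound)
    where
    in-own-fibre : xs ⊆ concatMap (fibre xs) labels
    in-own-fibre x∈xs = ∈-concatMap⁺ (fibre xs)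
      (Any.map (λ { refl → ∈-filter⁺ (λ x → φ x ≟ _) x∈xs refl }) (φ∈labels x∈xs))

module _ {P Q : Pred X 0ℓ} (P? : Decidable P) (Q? : Decidable Q) {xs : List X} (uniq : Unique xs)
         (P⇒Q : ∀ {x} → x ∈ xs → P x → Q x) where

  private
    filter-⊆ : filter P? xs ⊆ filter Q? xs
    filter-⊆ x∈ with ∈-filter⁻ P? {xs = xs} x∈
    ... | x∈xs , px = ∈-filter⁺ Q? x∈xs (P⇒Q x∈xs px)

  length-filter-mono : length (filter P? xs) ≤ length (filter Q? xs)
  length-filter-mono = Unique-length-≤ (filter⁺ P? uniq) filter-⊆

  length-filter-strict : ∀ {y} → y ∈ xs → Q y → ¬ P y → length (filter P? xs) < length (filter Q? xs)
  length-filter-strict {y} y∈xs qy ¬py = Unique-length-≤ (y∉ ∷ filter⁺ P? uniq) λ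
    { (here refl) → ∈-filter⁺ Q? y∈xs qy
    ; (there x∈) → filter-⊆ x∈ }
    where
    y∉ : All (y ≢_) (filter P? xs)
    y∉ = All.tabulate λ x∈ y≡x → ¬py (subst P (sym y≡x) (proj₂ (∈-filter⁻ P? {xs = xs} x∈)))

Unique-resp-⊇ : ∀ {xs ys : List X} → xs Sublist.⊆ ys → Unique ys → Unique xs
Unique-resp-⊇ Sublist.[]         []          = []
Unique-resp-⊇ (y Sublist.∷ʳ τ)   (_ ∷ uniq)  = Unique-resp-⊇ τ uniq
Unique-resp-⊇ (refl Sublist.∷ τ) (y∉ ∷ uniq) = Sublistₚ.All-resp-⊆ τ y∉ ∷ Unique-resp-⊇ τ uniq

nonempty : ∀ (xs : List X) → 1 ≤ length xs → Σ X (_∈ xs)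
nonempty (x ∷ _) _ = x , here refl

Unique-map-injectiveOn : ∀ (g : X → Y) {xs} → (∀ {x y} → x ∈ xs → y ∈ xs → g x ≡ g y → x ≡ y) →
                         Unique xs → Unique (map g xs)
Unique-map-injectiveOn g {[]}     _     []         = []
Unique-map-injectiveOn g {x ∷ xs} g-inj (x∉ ∷ uniq) =
  All-map⁺ (All.tabulate λ y∈ gx≡gy → All.lookup x∉ y∈ (g-inj (here refl) (there y∈) gx≡gy))
  ∷ Unique-map-injectiveOn g (λ x∈ y∈ → g-inj (there x∈) (there y∈)) uniq

strictlyAntitone⇒injective : ∀ {P : Pred ℕ 0ℓ} (μ : ℕ → ℕ) → (∀ {x y} → P y → x < y → μ y < μ x) →
                             ∀ {x y} → P x → P y → μ x ≡ μ y → x ≡ y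
strictlyAntitone⇒injective μ antitone {x} {y} px py μx≡μy with <-cmp x y
... | tri< x<y _ _ = ⊥-elim (<-irrefl (sym μx≡μy) (antitone py x<y))
... | tri≈ _ x≡y _ = x≡y
... | tri> _ _ y<x = ⊥-elim (<-irrefl μx≡μy (antitone px y<x))

∈-take : ∀ {x : X} n {xs} → x ∈ take n xs → x ∈ xs
∈-take n {xs} = Sublistₚ.Any-resp-⊆ (Sublistₚ.take-⊆ n xs)

length-take-≤ : ∀ n {xs : List X} → n ≤ length xs → length (take n xs) ≡ n
length-take-≤ n {xs} n≤ = trans (length-take n xs) (m≤n⇒m⊓n≡m n≤)

module _ {P : Pred ℕ 0ℓ} (P? : Decidable P) where

  -- The largest t ≤ n with P t, and 0 if there is none.
  greatest : ℕ → ℕ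
  greatest zero = zero
  greatest (suc n) with P? (suc n)
  ... | yes _ = suc n
  ... | no  _ = greatest n

  greatest-≤ : ∀ n → greatest n ≤ n
  greatest-≤ zero = z≤n
  greatest-≤ (suc n) with P? (suc n)
  ... | yes _ = ≤-refl
  ... | no  _ = m≤n⇒m≤1+n (greatest-≤ n)

  greatest-spec : ∀ {t} n → P t → t ≤ n → P (greatest n) × t ≤ greatest n
  greatest-spec zero pt z≤n = pt , z≤n
  greatest-spec {t} (suc n) pt t≤1+n with P? (suc n) | m≤n⇒m<n∨m≡n t≤1+n
  ... | yes p | _         = p , t≤1+n
  ... | no  _ | inj₁ t<1+n = greatest-spec n pt (≤-pred t<1+n)
  ... | no ¬p | inj₂ refl = contradiction pt ¬p

⌊n/2⌋*2≤n : ∀ n → ⌊ n /2⌋ * 2 ≤ n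
⌊n/2⌋*2≤n zero          = z≤n
⌊n/2⌋*2≤n (suc zero)    = z≤n
⌊n/2⌋*2≤n (suc (suc n)) = s≤s (s≤s (⌊n/2⌋*2≤n n))

n≤1+⌊n/2⌋*2 : ∀ n → n ≤ suc (⌊ n /2⌋ * 2)
n≤1+⌊n/2⌋*2 zero          = z≤n
n≤1+⌊n/2⌋*2 (suc zero)    = s≤s z≤n
n≤1+⌊n/2⌋*2 (suc (suc n)) = s≤s (s≤s (n≤1+⌊n/2⌋*2 n))

n<2^n : ∀ n → n < 2 ^ n
n<2^n zero    = s≤s z≤n
n<2^n (suc n) = +-mono-≤ (m^n>0 2 n) (≤-trans (n<2^n n) (m≤m+n (2 ^ n) 0))

halvings : ℕ → ℕ → ℕ
halvings R zero    = R
halvings R (suc l) = ⌊ halvings R l /2⌋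

roundDown : ℕ → ℕ → ℕ
roundDown R l = halvings R l * 2 ^ l

roundDown-suc : ∀ R l → roundDown R (suc l) ≡ halvings R (suc l) * 2 * 2 ^ l
roundDown-suc R l = sym (*-assoc (halvings R (suc l)) 2 (2 ^ l))

roundDown-≤ : ∀ R l → roundDown R l ≤ R
roundDown-≤ R zero    = ≤-reflexive (*-identityʳ R)
roundDown-≤ R (suc l) = begin
  roundDown R (suc l)                ≡⟨ roundDown-suc R l ⟩
  halvings R (suc l) * 2 * 2 ^ l     ≤⟨ *-monoˡ-≤ (2 ^ l) (⌊n/2⌋*2≤n (halvings R l)) ⟩
  roundDown R l                      ≤⟨ roundDown-≤ R l ⟩
  R                                  ∎
  where open ≤-Reasoning

roundDown-suc-≥ : ∀ R l → (halvings R l ∸ 1) * 2 ^ l ≤ roundDown R (suc l)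
roundDown-suc-≥ R l = subst ((halvings R l ∸ 1) * 2 ^ l ≤_) (sym (roundDown-suc R l))
  (*-monoˡ-≤ (2 ^ l) (∸-monoˡ-≤ 1 (n≤1+⌊n/2⌋*2 (halvings R l))))

Window : ℕ → ℕ → ℕ → Set
Window R l x = roundDown R (suc l) < x × x ≤ roundDown R l

private
  halvings-≤ : ∀ {R R' l x} → Window R l x → Window R' l x → halvings R' l ≤ halvings R l
  halvings-≤ {R} {R'} {l} {x} (_ , x≤) (R'<x , _) = ≤-trans (m≤n+m∸n (halvings R' l) 1)
    (*-cancelʳ-< (2 ^ l) (halvings R' l ∸ 1) (halvings R l)
      (<-≤-trans (≤-<-trans (roundDown-suc-≥ R' l) R'<x) x≤))

-- Both sides are the least multiple of 2 ^ l that is at least x.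
roundDown-window-unique : ∀ {R R' l x} → Window R l x → Window R' l x → roundDown R l ≡ roundDown R' l
roundDown-window-unique {R} {R'} {l} {x} w w' =
  cong (_* 2 ^ l) (≤-antisym (halvings-≤ {R'} {R} {l} {x} w' w) (halvings-≤ {R} {R'} {l} {x} w w'))

2^l≤R : ∀ {R l x} → 1 ≤ x → x ≤ roundDown R l → 2 ^ l ≤ R
2^l≤R {R} {l} 1≤x x≤ = ≤-trans (positive-multiple (halvings R l) (≤-trans 1≤x x≤)) (roundDown-≤ R l)
  where
  positive-multiple : ∀ h → 1 ≤ h * 2 ^ l → 2 ^ l ≤ h * 2 ^ l
  positive-multiple (suc h) _ = m≤m+n (2 ^ l) (h * 2 ^ l)

dyadicLevel : ℕ → ℕ → ℕ
dyadicLevel x R = greatest (λ l → x ≤? roundDown R l) R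

dyadicLevel-window : ∀ {x R} → 1 ≤ x → x ≤ R → Window R (dyadicLevel x R) x
dyadicLevel-window {x} {R} 1≤x x≤R = ≰⇒> beyond , in-window
  where
  x≤? = λ l → x ≤? roundDown R l
  in-window : x ≤ roundDown R (dyadicLevel x R)
  in-window = proj₁ (greatest-spec x≤? R (subst (x ≤_) (sym (*-identityʳ R)) x≤R) z≤n)
  beyond : ¬ x ≤ roundDown R (suc (dyadicLevel x R))
  beyond x≤ = 1+n≰n (proj₂ (greatest-spec x≤? R x≤
    (<⇒≤ (<-≤-trans (n<2^n (suc (dyadicLevel x R))) (2^l≤R {R} {suc (dyadicLevel x R)} 1≤x x≤)))))

E : Graph → List (ℕ × ℕ)
E G = map endpoints G

module _ {G : Graph} where

  ∈E⁻ : ∀ {x y} → (x , y) ∈ E G → Σ Edge λ e → e ∈ G × lo e ≡ x × hi e ≡ y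
  ∈E⁻ xy∈ with ∈-map⁻ endpoints xy∈
  ... | e , e∈G , refl = e , e∈G , refl , refl

  ∈E⇒< : ∀ {x y} → (x , y) ∈ E G → x < y
  ∈E⇒< xy∈ with ∈E⁻ xy∈
  ... | e , _ , refl , refl = ord e

  Adj⇒∈E : ∀ {x y} → Adj G x y → x < y → (x , y) ∈ E G
  Adj⇒∈E (e , e∈G , inj₁ (refl , refl)) _   = ∈-map⁺ endpoints e∈G
  Adj⇒∈E (e , e∈G , inj₂ (refl , refl)) y<x = ⊥-elim (<-asym y<x (ord e))

incidentᵇ⇒∈ₑ : ∀ {u} e → T (incidentᵇ u e) → u ∈ₑ e
incidentᵇ⇒∈ₑ {u} e t with Equivalence.to T-∨ t
... | inj₁ t-lo = inj₁ (sym (≡ᵇ⇒≡ (lo e) u t-lo))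
... | inj₂ t-hi = inj₂ (sym (≡ᵇ⇒≡ (hi e) u t-hi))

∈ₑ⇒incidentᵇ : ∀ {u} e → u ∈ₑ e → T (incidentᵇ u e)
∈ₑ⇒incidentᵇ {u} e (inj₁ u≡lo) = Equivalence.from T-∨ (inj₁ (≡⇒≡ᵇ (lo e) u (sym u≡lo)))
∈ₑ⇒incidentᵇ {u} e (inj₂ u≡hi) = Equivalence.from T-∨ (inj₂ (≡⇒≡ᵇ (hi e) u (sym u≡hi)))

module _ {u w : ℕ} where

  private
    edgeIsᵇ⇒ : ∀ e → T (edgeIsᵇ u w e) → ((lo e ≡ u) × (hi e ≡ w)) ⊎ ((lo e ≡ w) × (hi e ≡ u))
    edgeIsᵇ⇒ e t with Equivalence.to T-∨ t
    ... | inj₁ t-uw = let (t-lo , t-hi) = Equivalence.to T-∧ t-uw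
                      in inj₁ (≡ᵇ⇒≡ (lo e) u t-lo , ≡ᵇ⇒≡ (hi e) w t-hi)
    ... | inj₂ t-wu = let (t-lo , t-hi) = Equivalence.to T-∧ t-wu
                      in inj₂ (≡ᵇ⇒≡ (lo e) w t-lo , ≡ᵇ⇒≡ (hi e) u t-hi)

    ⇒edgeIsᵇ : ∀ e → ((lo e ≡ u) × (hi e ≡ w)) ⊎ ((lo e ≡ w) × (hi e ≡ u)) → T (edgeIsᵇ u w e)
    ⇒edgeIsᵇ e (inj₁ (lo≡u , hi≡w)) =
      Equivalence.from T-∨ (inj₁ (Equivalence.from T-∧ (≡⇒≡ᵇ (lo e) u lo≡u , ≡⇒≡ᵇ (hi e) w hi≡w)))
    ⇒edgeIsᵇ e (inj₂ (lo≡w , hi≡u)) =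
      Equivalence.from T-∨ (inj₂ (Equivalence.from T-∧ (≡⇒≡ᵇ (lo e) w lo≡w , ≡⇒≡ᵇ (hi e) u hi≡u)))

  adjᵇ⇒Adj : ∀ G → T (adjᵇ G u w) → Adj G u w
  adjᵇ⇒Adj G t with find (any⁻ (edgeIsᵇ u w) G t)
  ... | e , e∈G , t-e = e , e∈G , edgeIsᵇ⇒ e t-e

  Adj⇒adjᵇ : ∀ G → Adj G u w → T (adjᵇ G u w)
  Adj⇒adjᵇ G (e , e∈G , joins) = any⁺ (edgeIsᵇ u w) (Any.map (λ { refl → ⇒edgeIsᵇ e joins }) e∈G)

Simple-filter : ∀ {P : Pred Edge 0ℓ} (P? : Decidable P) {G} → Simple G → Simple (filter P? G)
Simple-filter P? {G} = Unique-resp-⊇ (Sublistₚ.map⁺ endpoints (Sublistₚ.filter-⊆ P? G))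

incidentPairs : Graph → ℕ → List (ℕ × ℕ)
incidentPairs H u = E (filterᵇ (incidentᵇ u) H)

module _ {H : Graph} {u : ℕ} where

  ∈-incidentPairs⁺ : ∀ {e} → e ∈ H → u ∈ₑ e → endpoints e ∈ incidentPairs H u
  ∈-incidentPairs⁺ {e} e∈H u∈e =
    ∈-map⁺ endpoints (∈-filter⁺ (T? ∘ incidentᵇ u) e∈H (∈ₑ⇒incidentᵇ e u∈e))

  ∈-incidentPairs⁻ : ∀ {p} → p ∈ incidentPairs H u → Σ Edge λ e → e ∈ H × u ∈ₑ e × p ≡ endpoints e
  ∈-incidentPairs⁻ p∈ with ∈-map⁻ endpoints p∈
  ... | e , e∈ , refl with ∈-filter⁻ (T? ∘ incidentᵇ u) {xs = H} e∈
  ... | e∈H , t = e , e∈H , incidentᵇ⇒∈ₑ e t , refl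

  degree-≡ : ∀ {X} → Simple H → Unique X → X ⊆ incidentPairs H u → incidentPairs H u ⊆ X →
             degree H u ≡ length X
  degree-≡ simple uniq X⊆ ⊆X = trans (sym (length-map endpoints (filterᵇ (incidentᵇ u) H)))
    (≤-antisym (Unique-length-≤ (Simple-filter (T? ∘ incidentᵇ u) simple) ⊆X) (Unique-length-≤ uniq X⊆))

  nbrsIn-≡ : ∀ {S Y} → Unique S → Unique Y → Y ⊆ S → (∀ {w} → w ∈ Y → Adj H u w) →
             (∀ {w} → w ∈ S → Adj H u w → w ∈ Y) → nbrsIn H u S ≡ length Y
  nbrsIn-≡ {S} uniqS uniqY Y⊆S Y-adj adj-Y = ≤-antisym
    (Unique-length-≤ (filter⁺ (T? ∘ adjᵇ H u) uniqS) λ w∈ →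
      let (w∈S , t) = ∈-filter⁻ (T? ∘ adjᵇ H u) {xs = S} w∈ in adj-Y w∈S (adjᵇ⇒Adj H t))
    (Unique-length-≤ uniqY λ w∈Y → ∈-filter⁺ (T? ∘ adjᵇ H u) (Y⊆S w∈Y) (Adj⇒adjᵇ H (Y-adj w∈Y)))

subgraph⇒≻ : ∀ {G H} → Simple H → (∀ {e} → e ∈ H → e ∈ G) → G ≻ H
subgraph⇒≻ {G} {H} simple H⊆G = record
  { F      = λ x → x
  ; f      = position
  ; F-vert = λ { _ (e , e∈H , x∈e) → e , H⊆G e∈H , x∈e }
  ; F-incr = λ _ _ _ _ x<y → x<y
  ; f-inj  = λ i j eq → lookup-injective endpoints simple i j
               (cong endpoints (trans (lookup-position i) (trans (cong (lookup G) eq) (sym (lookup-position j)))))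
  ; incid  = λ i x x∈e → subst (x ∈ₑ_) (lookup-position i) x∈e
  }
  where
  position : Fin (length H) → Fin (length G)
  position i = index (H⊆G (∈-lookup {xs = H} i))
  lookup-position : ∀ i → lookup H i ≡ lookup G (position i)
  lookup-position i = lookup-index (H⊆G (∈-lookup {xs = H} i))

edgeIndices : (G : Graph) → List (ℕ × ℕ) → List (Fin (length G))
edgeIndices G Y = filter (λ i → endpoints (lookup G i) ∈²? Y) (allFin (length G))

module _ {G : Graph} {Y : List (ℕ × ℕ)} where

  edgeIndices-unique : Unique (edgeIndices G Y)
  edgeIndices-unique = filter⁺ (λ i → endpoints (lookup G i) ∈²? Y) (allFin⁺ (length G))

  ∈-edgeIndices⁻ : ∀ {i} → i ∈ edgeIndices G Y → endpoints (lookup G i) ∈ Y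
  ∈-edgeIndices⁻ i∈ = proj₂ (∈-filter⁻ (λ i → endpoints (lookup G i) ∈²? Y) {xs = allFin (length G)} i∈)

  length-edgeIndices : Unique Y → Y ⊆ E G → length Y ≤ length (edgeIndices G Y)
  length-edgeIndices uniq Y⊆E = subst (length Y ≤_) (length-map _ (edgeIndices G Y))
    (Unique-length-≤ uniq λ p∈Y → hit p∈Y (Y⊆E p∈Y))
    where
    ends : Fin (length G) → ℕ × ℕ
    ends i = endpoints (lookup G i)
    hit : ∀ {p} → p ∈ Y → p ∈ E G → p ∈ map ends (edgeIndices G Y)
    hit p∈Y p∈E with ∈-map⁻ endpoints p∈E
    ... | e , e∈G , refl =
      let ends≡ = cong endpoints (lookup-index e∈G)
      in subst (_∈ map ends (edgeIndices G Y)) (sym ends≡)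
           (∈-map⁺ ends (∈-filter⁺ (λ i → ends i ∈²? Y) (∈-allFin (index e∈G)) (subst (_∈ Y) ends≡ p∈Y)))

vertex-by-incidence : ∀ {G′ G : Graph} {F : ℕ → ℕ} (f : Fin (length G′) → Fin (length G)) →
                      (∀ i v → v ∈ₑ lookup G′ i → F v ∈ₑ lookup G (f i)) →
                      ∀ v → v ∈V G′ → F v ∈V G
vertex-by-incidence {G′} {G} f incid v (e , e∈ , v∈e) =
    lookup G (f (index e∈))
  , ∈-lookup {xs = G} (f (index e∈))
  , incid (index e∈) v (subst (v ∈ₑ_) (lookup-index e∈) v∈e)

Adj-sym : ∀ {G x y} → Adj G x y → Adj G y x
Adj-sym (e , e∈G , inj₁ joins) = e , e∈G , inj₂ joins
Adj-sym (e , e∈G , inj₂ joins) = e , e∈G , inj₁ joins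

neighbourEdges : (G : Graph) → ℕ → List ℕ → List (Fin (length G))
neighbourEdges G a S = edgeIndices G (map (a ,_) (filterᵇ (adjᵇ G a) S))

module _ {G : Graph} {a : ℕ} {S : List ℕ} where

  ∈-neighbourEdges⁻ : ∀ {i} → i ∈ neighbourEdges G a S →
                      Σ ℕ λ s → s ∈ S × endpoints (lookup G i) ≡ (a , s)
  ∈-neighbourEdges⁻ i∈ with ∈-map⁻ (a ,_) (∈-edgeIndices⁻ {G} i∈)
  ... | s , s∈ , ends≡ = s , proj₁ (∈-filter⁻ (T? ∘ adjᵇ G a) {xs = S} s∈) , ends≡

  nbrsIn-≤-neighbourEdges : Unique S → (∀ {s} → s ∈ S → a < s) → nbrsIn G a S ≤ length (neighbourEdges G a S)
  nbrsIn-≤-neighbourEdges uniq a<S =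
    subst (_≤ length (neighbourEdges G a S)) (length-map (a ,_) (filterᵇ (adjᵇ G a) S))
    (length-edgeIndices {G} (map⁺ (cong proj₂) (filter⁺ (T? ∘ adjᵇ G a) uniq)) λ p∈ →
      let (s , s∈ , p≡) = ∈-map⁻ (a ,_) p∈ ; (s∈S , t) = ∈-filter⁻ (T? ∘ adjᵇ G a) {xs = S} s∈
      in subst (_∈ E G) (sym p≡) (Adj⇒∈E (adjᵇ⇒Adj G t) (a<S s∈S)))

-- A k-multiple of G₁ inside G: leaves, centre, near a and far a play the roles of A, v, and
-- the neighbours of a in B and in C.
record Layout (k : ℕ) (G : Graph) : Set where
  field
    centre        : ℕ
    leaves        : List ℕ
    near far      : ℕ → List ℕ
    leaves-unique : Unique leaves
    near-unique   : ∀ a → Unique (near a)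
    far-unique    : ∀ a → Unique (far a)
    #leaves       : length leaves ≡ k
    #near         : ∀ {a} → a ∈ leaves → length (near a) ≡ k
    #far          : ∀ {a} → a ∈ leaves → length (far a) ≡ k
    leaf-centre   : ∀ {a} → a ∈ leaves → (a , centre) ∈ E G
    leaf-near     : ∀ {a u} → a ∈ leaves → u ∈ near a → (a , u) ∈ E G
    leaf-far      : ∀ {a u} → a ∈ leaves → u ∈ far a → (a , u) ∈ E G
    centre<near   : ∀ {a u} → a ∈ leaves → u ∈ near a → centre < u
    near<far      : ∀ {a a′ u u′} → a ∈ leaves → a′ ∈ leaves → u ∈ near a → u′ ∈ far a′ → u < u′

module FromLayout {k G} (simple : Simple G) (1≤k : 1 ≤ k) (L : Layout k G) where
  open Layout L

  targets : ℕ → List ℕ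
  targets a = centre ∷ near a ++ far a

  Kept : Edge → Set
  Kept e = lo e ∈ leaves × hi e ∈ targets (lo e)

  kept? : Decidable Kept
  kept? e = (lo e ∈? leaves) ×-dec (hi e ∈? targets (lo e))

  H : Graph
  H = filter kept? G

  Near Far : List ℕ
  Near = deduplicate _≟_ (concatMap near leaves)
  Far  = deduplicate _≟_ (concatMap far leaves)

  ∈H⁻ : ∀ {e} → e ∈ H → e ∈ G × Kept e
  ∈H⁻ = ∈-filter⁻ kept? {xs = G}

  kept⁺ : ∀ {a u} → a ∈ leaves → u ∈ targets a → (a , u) ∈ E G →
          Σ Edge λ e → e ∈ H × lo e ≡ a × hi e ≡ u
  kept⁺ a∈ u∈ au∈E with ∈E⁻ au∈E
  ... | e , e∈G , refl , refl = e , ∈-filter⁺ kept? e∈G (a∈ , u∈) , refl , refl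

  ∈Near⁻ : ∀ {u} → u ∈ Near → Σ ℕ λ a → a ∈ leaves × u ∈ near a
  ∈Near⁻ u∈ = find (∈-concatMap⁻ near {xs = leaves} (∈-deduplicate⁻ _≟_ (concatMap near leaves) u∈))

  ∈Far⁻ : ∀ {u} → u ∈ Far → Σ ℕ λ a → a ∈ leaves × u ∈ far a
  ∈Far⁻ u∈ = find (∈-concatMap⁻ far {xs = leaves} (∈-deduplicate⁻ _≟_ (concatMap far leaves) u∈))

  ∈Near⁺ : ∀ {a u} → a ∈ leaves → u ∈ near a → u ∈ Near
  ∈Near⁺ a∈ u∈ = ∈-deduplicate⁺ _≟_ (∈-concatMap⁺ near (Any.map (λ { refl → u∈ }) a∈))

  ∈Far⁺ : ∀ {a u} → a ∈ leaves → u ∈ far a → u ∈ Far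
  ∈Far⁺ a∈ u∈ = ∈-deduplicate⁺ _≟_ (∈-concatMap⁺ far (Any.map (λ { refl → u∈ }) a∈))

  some-leaf : Σ ℕ (_∈ leaves)
  some-leaf = nonempty leaves (subst (1 ≤_) (sym #leaves) 1≤k)

  leaf<centre : ∀ {a} → a ∈ leaves → a < centre
  leaf<centre a∈ = ∈E⇒< (leaf-centre a∈)

  centre<far : ∀ {a u} → a ∈ leaves → u ∈ far a → centre < u
  centre<far a∈ u∈ =
    let (b , b∈) = nonempty (near _) (subst (1 ≤_) (sym (#near a∈)) 1≤k)
    in <-trans (centre<near a∈ b∈) (near<far a∈ a∈ b∈ u∈)

  centre<near++far : ∀ {a u} → a ∈ leaves → u ∈ near a ++ far a → centre < u
  centre<near++far {a} a∈ u∈ with ∈-++⁻ (near a) u∈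
  ... | inj₁ u∈near = centre<near a∈ u∈near
  ... | inj₂ u∈far  = centre<far a∈ u∈far

  centre≤target : ∀ {a u} → a ∈ leaves → u ∈ targets a → centre ≤ u
  centre≤target a∈ (here refl) = ≤-refl
  centre≤target a∈ (there u∈)  = <⇒≤ (centre<near++far a∈ u∈)

  targets-unique : ∀ {a} → a ∈ leaves → Unique (targets a)
  targets-unique {a} a∈ = All.tabulate centre≢ ∷ ++⁺ (near-unique a) (far-unique a) near∩far
    where
    centre≢ : ∀ {u} → u ∈ near a ++ far a → centre ≢ u
    centre≢ u∈ refl = <-irrefl refl (centre<near++far a∈ u∈)
    near∩far : ∀ {u} → ¬ (u ∈ near a × u ∈ far a)
    near∩far (u∈near , u∈far) = <-irrefl refl (near<far a∈ a∈ u∈near u∈far)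

  target-edge : ∀ {a u} → a ∈ leaves → u ∈ targets a → (a , u) ∈ E G
  target-edge a∈ (here refl) = leaf-centre a∈
  target-edge {a} a∈ (there u∈) with ∈-++⁻ (near a) u∈
  ... | inj₁ u∈near = leaf-near a∈ u∈near
  ... | inj₂ u∈far  = leaf-far a∈ u∈far

  #targets : ∀ {a} → a ∈ leaves → length (targets a) ≡ suc (k + k)
  #targets {a} a∈ = cong suc (trans (length-++ (near a)) (cong₂ _+_ (#near a∈) (#far a∈)))

  vertices : ∀ u → u ∈V H → (u ∈ leaves) ⊎ (u ≡ centre) ⊎ (u ∈ Near) ⊎ (u ∈ Far)
  vertices u (e , e∈H , inj₁ refl) = inj₁ (proj₁ (proj₂ (∈H⁻ e∈H)))
  vertices u (e , e∈H , inj₂ refl) with proj₂ (∈H⁻ e∈H)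
  ... | lo∈ , here hi≡centre = inj₂ (inj₁ hi≡centre)
  ... | lo∈ , there hi∈ with ∈-++⁻ (near (lo e)) hi∈
  ...   | inj₁ hi∈near = inj₂ (inj₂ (inj₁ (∈Near⁺ lo∈ hi∈near)))
  ...   | inj₂ hi∈far  = inj₂ (inj₂ (inj₂ (∈Far⁺ lo∈ hi∈far)))

  vertices⁻ : ∀ u → (u ∈ leaves) ⊎ (u ≡ centre) ⊎ (u ∈ Near) ⊎ (u ∈ Far) → u ∈V H
  vertices⁻ u (inj₁ u∈) with kept⁺ u∈ (here refl) (leaf-centre u∈)
  ... | e , e∈H , lo≡u , _ = e , e∈H , inj₁ (sym lo≡u)
  vertices⁻ u (inj₂ (inj₁ refl)) with kept⁺ (proj₂ some-leaf) (here refl) (leaf-centre (proj₂ some-leaf))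
  ... | e , e∈H , _ , hi≡u = e , e∈H , inj₂ (sym hi≡u)
  vertices⁻ u (inj₂ (inj₂ (inj₁ u∈))) with ∈Near⁻ u∈
  ... | a , a∈ , u∈near with kept⁺ a∈ (there (∈-++⁺ˡ u∈near)) (leaf-near a∈ u∈near)
  ...   | e , e∈H , _ , hi≡u = e , e∈H , inj₂ (sym hi≡u)
  vertices⁻ u (inj₂ (inj₂ (inj₂ u∈))) with ∈Far⁻ u∈
  ... | a , a∈ , u∈far with kept⁺ a∈ (there (∈-++⁺ʳ (near a) u∈far)) (leaf-far a∈ u∈far)
  ...   | e , e∈H , _ , hi≡u = e , e∈H , inj₂ (sym hi≡u)

  simpleH : Simple H
  simpleH = Simple-filter kept? simple

  degree-centre : degree H centre ≡ k
  degree-centre = trans (degree-≡ simpleH (map⁺ (cong proj₁) leaves-unique) ⊆incident incident⊆)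
                        (trans (length-map _ leaves) #leaves)
    where
    ⊆incident : map (_, centre) leaves ⊆ incidentPairs H centre
    ⊆incident p∈ with ∈-map⁻ (_, centre) p∈
    ... | a , a∈ , refl with kept⁺ a∈ (here refl) (leaf-centre a∈)
    ...   | e , e∈H , refl , hi≡ = subst (_∈ incidentPairs H centre) (cong (lo e ,_) hi≡)
                                     (∈-incidentPairs⁺ e∈H (inj₂ (sym hi≡)))
    incident⊆ : incidentPairs H centre ⊆ map (_, centre) leaves
    incident⊆ p∈ with ∈-incidentPairs⁻ {H} {centre} p∈
    ... | e , e∈H , inj₁ refl , refl = ⊥-elim (<-irrefl refl (leaf<centre (proj₁ (proj₂ (∈H⁻ e∈H)))))
    ... | e , e∈H , inj₂ refl , refl = ∈-map⁺ (_, centre) (proj₁ (proj₂ (∈H⁻ e∈H)))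

  degree-leaf : ∀ {a} → a ∈ leaves → degree H a ≡ suc (k + k)
  degree-leaf {a} a∈ = trans (degree-≡ simpleH (map⁺ (cong proj₂) (targets-unique a∈)) ⊆incident incident⊆)
                             (trans (length-map _ (targets a)) (#targets a∈))
    where
    ⊆incident : map (a ,_) (targets a) ⊆ incidentPairs H a
    ⊆incident p∈ with ∈-map⁻ (a ,_) p∈
    ... | u , u∈ , refl with kept⁺ a∈ u∈ (target-edge a∈ u∈)
    ...   | e , e∈H , lo≡ , refl = subst (_∈ incidentPairs H a) (cong (_, hi e) lo≡)
                                     (∈-incidentPairs⁺ e∈H (inj₁ (sym lo≡)))
    incident⊆ : incidentPairs H a ⊆ map (a ,_) (targets a)
    incident⊆ p∈ with ∈-incidentPairs⁻ {H} {a} p∈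
    ... | e , e∈H , inj₁ refl , refl = ∈-map⁺ (a ,_) (proj₂ (proj₂ (∈H⁻ e∈H)))
    ... | e , e∈H , inj₂ refl , refl with ∈H⁻ e∈H
    ...   | _ , lo∈ , hi∈ = ⊥-elim (<-irrefl refl (<-≤-trans (leaf<centre a∈) (centre≤target lo∈ hi∈)))

  target-adj : ∀ {a u} → a ∈ leaves → u ∈ targets a → Adj H a u
  target-adj a∈ u∈ with kept⁺ a∈ u∈ (target-edge a∈ u∈)
  ... | e , e∈H , lo≡ , hi≡ = e , e∈H , inj₁ (lo≡ , hi≡)

  adj-target : ∀ {a u} → a ∈ leaves → centre < u → Adj H a u → u ∈ targets a
  adj-target a∈ centre<u adj with ∈E⁻ (Adj⇒∈E adj (<-trans (leaf<centre a∈) centre<u))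
  ... | e , e∈H , refl , refl = proj₂ (proj₂ (∈H⁻ e∈H))

  nbrs-near : ∀ {a} → a ∈ leaves → nbrsIn H a Near ≡ k
  nbrs-near {a} a∈ = trans (nbrsIn-≡ (deduplicate-! _) (near-unique a) (∈Near⁺ a∈)
                              (λ u∈ → target-adj a∈ (there (∈-++⁺ˡ u∈))) adj-near)
                            (#near a∈)
    where
    adj-near : ∀ {u} → u ∈ Near → Adj H a u → u ∈ near a
    adj-near u∈ adj with ∈Near⁻ u∈
    ... | b , b∈ , u∈near-b with adj-target a∈ (centre<near b∈ u∈near-b) adj
    ...   | here refl = ⊥-elim (<-irrefl refl (centre<near b∈ u∈near-b))
    ...   | there u∈′ with ∈-++⁻ (near a) u∈′
    ...     | inj₁ u∈near = u∈near
    ...     | inj₂ u∈far  = ⊥-elim (<-irrefl refl (near<far b∈ a∈ u∈near-b u∈far))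

  nbrs-far : ∀ {a} → a ∈ leaves → nbrsIn H a Far ≡ k
  nbrs-far {a} a∈ = trans (nbrsIn-≡ (deduplicate-! _) (far-unique a) (∈Far⁺ a∈)
                              (λ u∈ → target-adj a∈ (there (∈-++⁺ʳ (near a) u∈))) adj-far)
                            (#far a∈)
    where
    adj-far : ∀ {u} → u ∈ Far → Adj H a u → u ∈ far a
    adj-far u∈ adj with ∈Far⁻ u∈
    ... | b , b∈ , u∈far-b with adj-target a∈ (centre<far b∈ u∈far-b) adj
    ...   | here refl = ⊥-elim (<-irrefl refl (centre<far b∈ u∈far-b))
    ...   | there u∈′ with ∈-++⁻ (near a) u∈′
    ...     | inj₁ u∈near = ⊥-elim (<-irrefl refl (near<far a∈ b∈ u∈near u∈far-b))
    ...     | inj₂ u∈far  = u∈far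

  edge-kinds : ∀ e → e ∈ H →
               (lo e ∈ leaves × hi e ≡ centre) ⊎ (lo e ∈ leaves × hi e ∈ Near) ⊎ (lo e ∈ leaves × hi e ∈ Far)
  edge-kinds e e∈H with proj₂ (∈H⁻ e∈H)
  ... | lo∈ , here hi≡centre = inj₁ (lo∈ , hi≡centre)
  ... | lo∈ , there hi∈ with ∈-++⁻ (near (lo e)) hi∈
  ...   | inj₁ hi∈near = inj₂ (inj₁ (lo∈ , ∈Near⁺ lo∈ hi∈near))
  ...   | inj₂ hi∈far  = inj₂ (inj₂ (lo∈ , ∈Far⁺ lo∈ hi∈far))

  multiple : Multiple k H
  multiple = record
    { simple  = simpleH
    ; A = leaves ; B = Near ; C = Far ; v = centre
    ; uniqA   = leaves-unique
    ; uniqB   = deduplicate-! _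
    ; uniqC   = deduplicate-! _
    ; vset    = vertices
    ; vset⁻   = vertices⁻
    ; A<v     = λ _ a∈ → leaf<centre a∈
    ; v<B     = λ _ u∈ → let (a , a∈ , u∈near) = ∈Near⁻ u∈ in centre<near a∈ u∈near
    ; B<C     = λ _ _ u∈ u′∈ → let (a , a∈ , u∈near) = ∈Near⁻ u∈
                                   (a′ , a′∈ , u′∈far) = ∈Far⁻ u′∈
                               in near<far a∈ a′∈ u∈near u′∈far
    ; sizeA   = #leaves
    ; deg-v   = degree-centre
    ; v-A     = λ a a∈ → let (e , e∈H , lo≡ , hi≡) = kept⁺ a∈ (here refl) (leaf-centre a∈)
                         in e , e∈H , inj₂ (lo≡ , hi≡)
    ; deg-A   = λ _ → degree-leaf
    ; A-B     = λ _ → nbrs-near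
    ; A-C     = λ _ → nbrs-far
    ; noOther = edge-kinds
    }

Layout⇒≻Multiple : ∀ {k G} → Simple G → 1 ≤ k → Layout k G → Σ Graph λ H → Multiple k H × G ≻ H
Layout⇒≻Multiple simple 1≤k L = H , multiple , subgraph⇒≻ simpleH (λ e∈H → proj₁ (∈H⁻ e∈H))
  where open FromLayout simple 1≤k L

Rainbow : ∀ {G} → (Fin (length G) → ℕ) → Embedding G₁ G → Set
Rainbow χ emb = ∀ i j → χ (f emb i) ≡ χ (f emb j) → i ≡ j

module _ {G : Graph} (χ : Fin (length G) → ℕ) {k} (few : ∀ c → colourCount G χ c ≤ k) where

  freshColour : ∀ {is} → Unique is → (S : List ℕ) → length S * k < length is →
                Σ (Fin (length G)) λ i → i ∈ is × χ i ∉ S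
  freshColour {is} uniq S long with All.all? (λ i → χ i ∈? S) is
  ... | no ¬all = find (¬All⇒Any¬ (λ i → χ i ∈? S) is ¬all)
  ... | yes all = contradiction (length-≤-fibres _≟_ χ S uniq (All.lookup all) fibre-≤) (<⇒≱ long)
    where
    fibre-≤ : ∀ c → length (fibre _≟_ χ is c) ≤ k
    fibre-≤ c = ≤-trans (Unique-length-≤ (filter⁺ (λ i → χ i ≟ c) uniq) λ i∈ →
                  let χi≡c = proj₂ (∈-filter⁻ (λ i → χ i ≟ c) {xs = is} i∈)
                  in ∈-filter⁺ (λ i → T? (χ i ≡ᵇ c)) (∈-allFin _) (≡⇒≡ᵇ _ _ χi≡c))
                (few c)

data G₁-Vertex : ℕ → Set where
  one   : G₁-Vertex 1
  two   : G₁-Vertex 2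
  three : G₁-Vertex 3
  four  : G₁-Vertex 4
  five  : G₁-Vertex 5

G₁-vertex : ∀ {u} → u ∈V G₁ → G₁-Vertex u
G₁-vertex (_ , here refl , inj₁ refl)                         = one
G₁-vertex (_ , here refl , inj₂ refl)                         = three
G₁-vertex (_ , there (here refl) , inj₁ refl)                 = one
G₁-vertex (_ , there (here refl) , inj₂ refl)                 = five
G₁-vertex (_ , there (there (here refl)) , inj₁ refl)         = two
G₁-vertex (_ , there (there (here refl)) , inj₂ refl)         = three
G₁-vertex (_ , there (there (there (here refl))) , inj₁ refl) = two
G₁-vertex (_ , there (there (there (here refl))) , inj₂ refl) = four

record G₁-Pattern (G : Graph) (χ : Fin (length G) → ℕ) : Set where
  field
    x₁ x₂ x₃ x₄ x₅  : ℕ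
    x₁<x₂           : x₁ < x₂
    x₂<x₃           : x₂ < x₃
    x₃<x₄           : x₃ < x₄
    x₄<x₅           : x₄ < x₅
    e₁₃ e₁₅ e₂₃ e₂₄ : Fin (length G)
    ends₁₃          : endpoints (lookup G e₁₃) ≡ (x₁ , x₃)
    ends₁₅          : endpoints (lookup G e₁₅) ≡ (x₁ , x₅)
    ends₂₃          : endpoints (lookup G e₂₃) ≡ (x₂ , x₃)
    ends₂₄          : endpoints (lookup G e₂₄) ≡ (x₂ , x₄)
    rainbow         : Unique (map χ (e₁₃ ∷ e₁₅ ∷ e₂₃ ∷ e₂₄ ∷ []))

module _ {G : Graph} {χ : Fin (length G) → ℕ} (P : G₁-Pattern G χ) where
  open G₁-Pattern P

  private
    vertex : ℕ → ℕ
    vertex 1 = x₁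
    vertex 2 = x₂
    vertex 3 = x₃
    vertex 4 = x₄
    vertex 5 = x₅
    vertex _ = 0

    edge : Fin (length G₁) → Fin (length G)
    edge = lookup (e₁₃ ∷ e₁₅ ∷ e₂₃ ∷ e₂₄ ∷ [])

    incidence : ∀ i u → u ∈ₑ lookup G₁ i → vertex u ∈ₑ lookup G (edge i)
    incidence zero                            _ (inj₁ refl) = inj₁ (sym (cong proj₁ ends₁₃))
    incidence zero                            _ (inj₂ refl) = inj₂ (sym (cong proj₂ ends₁₃))
    incidence (suc zero)                      _ (inj₁ refl) = inj₁ (sym (cong proj₁ ends₁₅))
    incidence (suc zero)                      _ (inj₂ refl) = inj₂ (sym (cong proj₂ ends₁₅))
    incidence (suc (suc zero))                _ (inj₁ refl) = inj₁ (sym (cong proj₁ ends₂₃))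
    incidence (suc (suc zero))                _ (inj₂ refl) = inj₂ (sym (cong proj₂ ends₂₃))
    incidence (suc (suc (suc zero)))          _ (inj₁ refl) = inj₁ (sym (cong proj₁ ends₂₄))
    incidence (suc (suc (suc zero)))          _ (inj₂ refl) = inj₂ (sym (cong proj₂ ends₂₄))

    increasing : ∀ {u w} → G₁-Vertex u → G₁-Vertex w → u < w → vertex u < vertex w
    increasing one   two   _ = x₁<x₂
    increasing one   three _ = <-trans x₁<x₂ x₂<x₃
    increasing one   four  _ = <-trans x₁<x₂ (<-trans x₂<x₃ x₃<x₄)
    increasing one   five  _ = <-trans x₁<x₂ (<-trans x₂<x₃ (<-trans x₃<x₄ x₄<x₅))
    increasing two   three _ = x₂<x₃
    increasing two   four  _ = <-trans x₂<x₃ x₃<x₄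
    increasing two   five  _ = <-trans x₂<x₃ (<-trans x₃<x₄ x₄<x₅)
    increasing three four  _ = x₃<x₄
    increasing three five  _ = <-trans x₃<x₄ x₄<x₅
    increasing four  five  _ = x₄<x₅
    increasing one   one   (s≤s ())
    increasing two   one   (s≤s ())
    increasing three one   (s≤s ())
    increasing four  one   (s≤s ())
    increasing five  one   (s≤s ())
    increasing two   two   (s≤s (s≤s ()))
    increasing three two   (s≤s (s≤s ()))
    increasing four  two   (s≤s (s≤s ()))
    increasing five  two   (s≤s (s≤s ()))
    increasing three three (s≤s (s≤s (s≤s ())))
    increasing four  three (s≤s (s≤s (s≤s ())))
    increasing five  three (s≤s (s≤s (s≤s ())))
    increasing four  four  (s≤s (s≤s (s≤s (s≤s ()))))
    increasing five  four  (s≤s (s≤s (s≤s (s≤s ()))))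
    increasing five  five  (s≤s (s≤s (s≤s (s≤s (s≤s ())))))

    colours-distinct : ∀ i j → χ (edge i) ≡ χ (edge j) → i ≡ j
    colours-distinct = lookup-injective χ rainbow

  rainbowCopy : Σ (Embedding G₁ G) (Rainbow χ)
  rainbowCopy = record
    { F      = vertex
    ; f      = edge
    ; F-vert = vertex-by-incidence edge incidence
    ; F-incr = λ _ _ u∈ w∈ → increasing (G₁-vertex u∈) (G₁-vertex w∈)
    ; f-inj  = λ i j eq → colours-distinct i j (cong χ eq)
    ; incid  = incidence
    } , colours-distinct

fresh⇒rainbow : ∀ {c₁₃ c₁₅ c₂₃ c₂₄ : ℕ} →
                c₁₃ ≢ c₂₃ → c₂₄ ∉ c₂₃ ∷ c₁₃ ∷ [] → c₁₅ ∉ c₂₄ ∷ c₂₃ ∷ c₁₃ ∷ [] →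
                Unique (c₁₃ ∷ c₁₅ ∷ c₂₃ ∷ c₂₄ ∷ [])
fresh⇒rainbow c₁₃≢c₂₃ c₂₄∉ c₁₅∉ =
    ((λ eq → c₁₅∉ (there (there (here (sym eq))))) ∷ c₁₃≢c₂₃ ∷ (λ eq → c₂₄∉ (there (here (sym eq)))) ∷ [])
  ∷ ((λ eq → c₁₅∉ (there (here eq))) ∷ (λ eq → c₁₅∉ (here eq)) ∷ [])
  ∷ ((λ eq → c₂₄∉ (here (sym eq))) ∷ [])
  ∷ []
  ∷ []

m*k<3k+1 : ∀ {m} k → m ≤ 3 → m * k < 3 * k + 1
m*k<3k+1 {m} k m≤3 = ≤-<-trans (*-monoˡ-≤ k m≤3) (m<m+n (3 * k) (s≤s z≤n))

module RainbowInMultiple {k G} (M : Multiple (3 * k + 1) G) (χ : Fin (length G) → ℕ)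
                         (few : ∀ c → colourCount G χ c ≤ k) where
  private module M = Multiple M

  pick : ∀ {is} → Unique is → (S : List ℕ) → length S ≤ 3 → 3 * k + 1 ≤ length is →
         Σ (Fin (length G)) λ i → i ∈ is × χ i ∉ S
  pick uniq S short long = freshColour {G} χ few uniq S (<-≤-trans (m*k<3k+1 k short) long)

  centreEdges : List (Fin (length G))
  centreEdges = edgeIndices G (map (_, M.v) M.A)

  #centreEdges : 3 * k + 1 ≤ length centreEdges
  #centreEdges = subst (_≤ length centreEdges) (trans (length-map (_, M.v) M.A) M.sizeA)
    (length-edgeIndices {G} (map⁺ (cong proj₁) M.uniqA) λ p∈ →
      let (a , a∈ , p≡) = ∈-map⁻ (_, M.v) p∈
      in subst (_∈ E G) (sym p≡) (Adj⇒∈E (Adj-sym (M.v-A a a∈)) (M.A<v a a∈)))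

  ∈-centreEdges⁻ : ∀ {i} → i ∈ centreEdges → Σ ℕ λ a → a ∈ M.A × endpoints (lookup G i) ≡ (a , M.v)
  ∈-centreEdges⁻ i∈ = ∈-map⁻ (_, M.v) (∈-edgeIndices⁻ {G} i∈)

  record Wedge : Set where
    field
      a₁ a₂   : ℕ
      a₁∈A    : a₁ ∈ M.A
      a₂∈A    : a₂ ∈ M.A
      a₁<a₂   : a₁ < a₂
      e₁₃ e₂₃ : Fin (length G)
      ends₁₃  : endpoints (lookup G e₁₃) ≡ (a₁ , M.v)
      ends₂₃  : endpoints (lookup G e₂₃) ≡ (a₂ , M.v)
      c₁₃≢c₂₃ : χ e₁₃ ≢ χ e₂₃

  wedge : Wedge
  wedge with pick (edgeIndices-unique {G}) [] z≤n #centreEdges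
  ... | i , i∈ , _ with pick (edgeIndices-unique {G}) (χ i ∷ []) (s≤s z≤n) #centreEdges
  ... | j , j∈ , χj∉ with ∈-centreEdges⁻ i∈ | ∈-centreEdges⁻ j∈
  ... | a , a∈ , ends-i | b , b∈ , ends-j with <-cmp a b
  ... | tri< a<b _ _ = record { a₁∈A = a∈ ; a₂∈A = b∈ ; a₁<a₂ = a<b ; ends₁₃ = ends-i ; ends₂₃ = ends-j
                              ; c₁₃≢c₂₃ = λ eq → χj∉ (here (sym eq)) }
  ... | tri> _ _ b<a = record { a₁∈A = b∈ ; a₂∈A = a∈ ; a₁<a₂ = b<a ; ends₁₃ = ends-j ; ends₂₃ = ends-i
                              ; c₁₃≢c₂₃ = λ eq → χj∉ (here eq) }
  ... | tri≈ _ refl _ = contradiction (here (cong χ (sym same-edge))) χj∉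
    where
    same-edge : i ≡ j
    same-edge = lookup-injective endpoints M.simple i j (trans ends-i (sym ends-j))

  open Wedge wedge

  #neighbourEdges : ∀ {a S} → a ∈ M.A → Unique S → (∀ {s} → s ∈ S → M.v < s) →
                    nbrsIn G a S ≡ 3 * k + 1 → 3 * k + 1 ≤ length (neighbourEdges G a S)
  #neighbourEdges {a} {S} a∈ uniq v<S #nbrs = subst (_≤ length (neighbourEdges G a S)) #nbrs
    (nbrsIn-≤-neighbourEdges {G} uniq λ s∈ → <-trans (M.A<v a a∈) (v<S s∈))

  rainbowPattern : G₁-Pattern G χ
  rainbowPattern =
    let (e₂₄ , e₂₄∈ , c₂₄∉) = pick (edgeIndices-unique {G}) (χ e₂₃ ∷ χ e₁₃ ∷ []) (s≤s (s≤s z≤n))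
                                (#neighbourEdges a₂∈A M.uniqB (M.v<B _) (M.A-B a₂ a₂∈A))
        (y , y∈B , ends₂₄) = ∈-neighbourEdges⁻ {G} e₂₄∈
        v<C : ∀ {z} → z ∈ M.C → M.v < z
        v<C z∈ = <-trans (M.v<B y y∈B) (M.B<C y _ y∈B z∈)
        (e₁₅ , e₁₅∈ , c₁₅∉) = pick (edgeIndices-unique {G}) (χ e₂₄ ∷ χ e₂₃ ∷ χ e₁₃ ∷ []) (s≤s (s≤s (s≤s z≤n)))
                                (#neighbourEdges a₁∈A M.uniqC v<C (M.A-C a₁ a₁∈A))
        (z , z∈C , ends₁₅) = ∈-neighbourEdges⁻ {G} e₁₅∈
    in record
    { x₁<x₂   = a₁<a₂
    ; x₂<x₃   = M.A<v a₂ a₂∈A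
    ; x₃<x₄   = M.v<B y y∈B
    ; x₄<x₅   = M.B<C y z y∈B z∈C
    ; ends₁₃  = ends₁₃
    ; ends₁₅  = ends₁₅
    ; ends₂₃  = ends₂₃
    ; ends₂₄  = ends₂₄
    ; rainbow = fresh⇒rainbow c₁₃≢c₂₃ c₂₄∉ c₁₅∉
    }

Multiple⇒BlowUp : ∀ k G → Multiple (3 * k + 1) G → InBlowUp k G₁ G
Multiple⇒BlowUp k G M = Multiple.simple M , λ χ few → rainbowCopy (RainbowInMultiple.rainbowPattern M χ few)

Label : Set
Label = ℕ ⊎ (ℕ × ℕ) ⊎ (ℕ × ℕ)

pattern final a    = inj₁ a
pattern sparse a l = inj₂ (inj₁ (a , l))
pattern dense w l  = inj₂ (inj₂ (w , l))

_≟ᴸ_ : DecidableEquality Label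
_≟ᴸ_ = ⊎-≡-dec _≟_ (⊎-≡-dec (×-≡-dec _≟_ _≟_) (×-≡-dec _≟_ _≟_))

module EdgeLabelling {k G} (1≤k : 1 ≤ k) (simple : Simple G) (avoids : AvoidsM k G) where

  V : List ℕ
  V = deduplicate _≟_ (vertexList G)

  rank : ℕ → ℕ
  rank x = length (filter (_≤? x) V)

  right : ℕ → List ℕ
  right a = filter (λ u → (a , u) ∈²? E G) V

  after : ℕ → ℕ → ℕ
  after a w = length (filter (w <?_) (right a))

  beyond : ℕ → ℕ → ℕ
  beyond a t = length (filter (λ u → t <? rank u) (right a))

  between : ℕ → ℕ → ℕ → ℕ
  between a w t = length (filter (λ u → (w <? u) ×-dec (rank u ≤? t)) (right a))

  reach : ℕ → ℕ
  reach a = greatest (λ t → k ≤? beyond a t) (length V)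

  level : ℕ → ℕ → ℕ
  level a w = dyadicLevel (rank w) (reach a)

  threshold : ℕ → ℕ → ℕ
  threshold a w = roundDown (reach a) (level a w)

  V-unique : Unique V
  V-unique = deduplicate-! (vertexList G)

  ∈E⇒∈V : ∀ {x y} → (x , y) ∈ E G → x ∈ V × y ∈ V
  ∈E⇒∈V xy∈ with ∈E⁻ xy∈
  ... | e , e∈G , refl , refl =
      ∈-deduplicate⁺ _≟_ (∈-concatMap⁺ (λ e → lo e ∷ hi e ∷ []) (Any.map (λ { refl → here refl }) e∈G))
    , ∈-deduplicate⁺ _≟_ (∈-concatMap⁺ (λ e → lo e ∷ hi e ∷ []) (Any.map (λ { refl → there (here refl) }) e∈G))

  rank-mono : ∀ {x y} → x ≤ y → rank x ≤ rank y
  rank-mono x≤y = length-filter-mono (_≤? _) (_≤? _) V-unique (λ _ u≤x → ≤-trans u≤x x≤y)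

  rank-strict : ∀ {x y} → x < y → y ∈ V → rank x < rank y
  rank-strict x<y y∈V =
    length-filter-strict (_≤? _) (_≤? _) V-unique (λ _ u≤x → ≤-trans u≤x (<⇒≤ x<y)) y∈V ≤-refl (<⇒≱ x<y)

  rank-pos : ∀ {y} → y ∈ V → 1 ≤ rank y
  rank-pos y∈V = filter-some (_≤? _) (Any.map (λ { refl → ≤-refl }) y∈V)

  right-unique : ∀ a → Unique (right a)
  right-unique a = filter⁺ (λ u → (a , u) ∈²? E G) V-unique

  ∈right⁺ : ∀ {a u} → (a , u) ∈ E G → u ∈ right a
  ∈right⁺ au∈ = ∈-filter⁺ (λ u → (_ , u) ∈²? E G) (proj₂ (∈E⇒∈V au∈)) au∈

  ∈right⁻ : ∀ {a u} → u ∈ right a → (a , u) ∈ E G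
  ∈right⁻ {a} u∈ = proj₂ (∈-filter⁻ (λ u → (a , u) ∈²? E G) {xs = V} u∈)

  after-antitone : ∀ {a w w′} → (a , w′) ∈ E G → w < w′ → after a w′ < after a w
  after-antitone aw′∈ w<w′ = length-filter-strict (_ <?_) (_ <?_) (right-unique _)
    (λ _ w′<u → <-trans w<w′ w′<u) (∈right⁺ aw′∈) w<w′ (<-irrefl refl)

  between-antitone : ∀ {a t w w′} → (a , w′) ∈ E G × rank w′ ≤ t → w < w′ → between a w′ t < between a w t
  between-antitone {t = t} (aw′∈ , rank≤t) w<w′ =
    length-filter-strict (λ u → (_ <? u) ×-dec (rank u ≤? t)) (λ u → (_ <? u) ×-dec (rank u ≤? t)) (right-unique _)
      (λ _ (w′<u , r) → <-trans w<w′ w′<u , r) (∈right⁺ aw′∈) (w<w′ , rank≤t) (λ (w′<w′ , _) → <-irrefl refl w′<w′)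

  module Long {a w} (aw∈E : (a , w) ∈ E G) (long : k ≤ after a w) where

    private
      k≤beyond-rank : k ≤ beyond a (rank w)
      k≤beyond-rank = ≤-trans long (length-filter-mono (_ <?_) (λ u → rank w <? rank u) (right-unique a)
        (λ u∈ w<u → rank-strict w<u (proj₂ (∈E⇒∈V (∈right⁻ u∈)))) )

      reach-spec = greatest-spec (λ t → k ≤? beyond a t) (length V) k≤beyond-rank (length-filter (_≤? w) V)

    rank≤reach : rank w ≤ reach a
    rank≤reach = proj₂ reach-spec

    window : Window (reach a) (level a w) (rank w)
    window = dyadicLevel-window (rank-pos (proj₂ (∈E⇒∈V aw∈E))) rank≤reach

    k≤beyond-threshold : k ≤ beyond a (threshold a w)
    k≤beyond-threshold = ≤-trans (proj₁ reach-spec)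
      (length-filter-mono (λ u → reach a <? rank u) (λ u → threshold a w <? rank u) (right-unique a)
        (λ _ → ≤-<-trans (roundDown-≤ (reach a) (level a w))))

    at-level : ∀ {l} → level a w ≡ l → threshold a w ≡ roundDown (reach a) l × Window (reach a) l (rank w)
    at-level refl = refl , window

    2^level≤|V| : 2 ^ level a w ≤ length V
    2^level≤|V| = ≤-trans (2^l≤R {reach a} {level a w} (rank-pos (proj₂ (∈E⇒∈V aw∈E))) (proj₂ window))
                          (greatest-≤ _ (length V))

  data Labelled (a w : ℕ) : Label → Set where
    is-final  : after a w < k → Labelled a w (final a)
    is-sparse : k ≤ after a w → between a w (threshold a w) < k → Labelled a w (sparse a (level a w))
    is-dense  : k ≤ after a w → k ≤ between a w (threshold a w) → Labelled a w (dense w (level a w))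

  classify : ∀ a w → Σ Label (Labelled a w)
  classify a w = decide (after a w <? k) (k ≤? between a w (threshold a w))
    where
    decide : Dec (after a w < k) → Dec (k ≤ between a w (threshold a w)) → Σ Label (Labelled a w)
    decide (yes short) _          = final a , is-final short
    decide (no long)   (no few)   = sparse a (level a w) , is-sparse (≮⇒≥ long) (≰⇒> few)
    decide (no long)   (yes many) = dense w (level a w) , is-dense (≮⇒≥ long) many

  label : ℕ × ℕ → Label
  label (a , w) = proj₁ (classify a w)

  class : Label → List (ℕ × ℕ)
  class = fibre _≟ᴸ_ label (E G)

  class-unique : ∀ l → Unique (class l)
  class-unique l = filter⁺ (λ p → label p ≟ᴸ l) simple

  ∈class⁻ : ∀ {a w l} → (a , w) ∈ class l → (a , w) ∈ E G × Labelled a w l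
  ∈class⁻ {a} {w} {l} aw∈ =
    let (aw∈E , labelled-l) = ∈-filter⁻ (λ p → label p ≟ᴸ l) {xs = E G} aw∈
    in aw∈E , subst (Labelled a w) labelled-l (proj₂ (classify a w))

  final⁻ : ∀ {a w a₀} → Labelled a w (final a₀) → a ≡ a₀ × after a w < k
  final⁻ (is-final short) = refl , short

  sparse⁻ : ∀ {a w a₀ l} → Labelled a w (sparse a₀ l) →
            a ≡ a₀ × level a w ≡ l × k ≤ after a w × between a w (threshold a w) < k
  sparse⁻ (is-sparse long few) = refl , refl , long , few

  dense⁻ : ∀ {a w w₀ l} → Labelled a w (dense w₀ l) →
           w ≡ w₀ × level a w ≡ l × k ≤ after a w × k ≤ between a w (threshold a w)
  dense⁻ (is-dense long many) = refl , refl , long , many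

  final-class-≤ : ∀ a₀ → length (class (final a₀)) ≤ k
  final-class-≤ a₀ = pigeonhole (uncurry after) (class-unique _) injective bounded
    where
    injective : ∀ {x y} → x ∈ class (final a₀) → y ∈ class (final a₀) → uncurry after x ≡ uncurry after y → x ≡ y
    injective {a , w} {a′ , w′} x∈ y∈ =
      let (x∈E , lx) = ∈class⁻ x∈
          (y∈E , ly) = ∈class⁻ y∈
      in same-end (proj₁ (final⁻ lx)) (proj₁ (final⁻ ly)) x∈E y∈E
      where
      same-end : a ≡ a₀ → a′ ≡ a₀ → (a , w) ∈ E G → (a′ , w′) ∈ E G → after a w ≡ after a′ w′ → (a , w) ≡ (a′ , w′)
      same-end refl refl x∈E y∈E eq = cong (a₀ ,_) (strictlyAntitone⇒injective (after a₀) after-antitone x∈E y∈E eq)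
    bounded : ∀ {x} → x ∈ class (final a₀) → uncurry after x < k
    bounded x∈ = proj₂ (final⁻ (proj₂ (∈class⁻ x∈)))

  sparse-class-≤ : ∀ a₀ l → length (class (sparse a₀ l)) ≤ k
  sparse-class-≤ a₀ l = pigeonhole μ (class-unique _) injective bounded
    where
    θ = roundDown (reach a₀) l

    μ : ℕ × ℕ → ℕ
    μ (a , w) = between a w (threshold a w)

    Below : ℕ → ℕ → Set
    Below a w = a ≡ a₀ × (a , w) ∈ E G × threshold a w ≡ roundDown (reach a) l × rank w ≤ roundDown (reach a) l

    below : ∀ {a w} → (a , w) ∈ class (sparse a₀ l) → Below a w
    below x∈ = let (x∈E , lx) = ∈class⁻ x∈
                   (a≡a₀ , lvl , long , _) = sparse⁻ lx
                   (thr≡ , window) = Long.at-level x∈E long lvl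
               in a≡a₀ , x∈E , thr≡ , proj₂ window

    same-end : ∀ {a a′ w w′} → Below a w → Below a′ w′ → μ (a , w) ≡ μ (a′ , w′) → (a , w) ≡ (a′ , w′)
    same-end {w = w} {w′} (refl , x∈E , thr≡ , rank≤) (refl , y∈E , thr′≡ , rank′≤) eq =
      cong (a₀ ,_) (strictlyAntitone⇒injective (λ w → between a₀ w θ) between-antitone (x∈E , rank≤) (y∈E , rank′≤)
        (subst₂ (λ t t′ → between a₀ w t ≡ between a₀ w′ t′) thr≡ thr′≡ eq))

    injective : ∀ {x y} → x ∈ class (sparse a₀ l) → y ∈ class (sparse a₀ l) → μ x ≡ μ y → x ≡ y
    injective {_ , _} {_ , _} x∈ y∈ = same-end (below x∈) (below y∈)

    bounded : ∀ {x} → x ∈ class (sparse a₀ l) → μ x < k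
    bounded {_ , _} x∈ = proj₂ (proj₂ (proj₂ (sparse⁻ (proj₂ (∈class⁻ x∈)))))

  module DenseLayout (w₀ l : ℕ) (many : k ≤ length (class (dense w₀ l))) where

    private
      D = class (dense w₀ l)

    on-centre : ∀ {a w} → (a , w) ∈ D → w ≡ w₀
    on-centre aw∈ = proj₁ (dense⁻ (proj₂ (∈class⁻ aw∈)))

    centred : ∀ {a w} → (a , w) ∈ D → (a , w₀) ∈ D
    centred aw∈ = subst (λ w → (_ , w) ∈ D) (on-centre aw∈) aw∈

    first : Σ ℕ λ a → (a , w₀) ∈ D
    first = let ((a , _) , aw∈) = nonempty D (≤-trans 1≤k many) in a , centred aw∈

    θ : ℕ
    θ = roundDown (reach (proj₁ first)) l

    on-level : ∀ {a} → (a , w₀) ∈ D → threshold a w₀ ≡ roundDown (reach a) l × Window (reach a) l (rank w₀)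
    on-level aw∈ = let (aw∈E , labelled) = ∈class⁻ aw∈ ; (_ , lvl , long , _) = dense⁻ labelled
                   in Long.at-level aw∈E long lvl

    threshold≡θ : ∀ {a} → (a , w₀) ∈ D → threshold a w₀ ≡ θ
    threshold≡θ {a} aw∈ = trans (proj₁ (on-level aw∈))
      (roundDown-window-unique {reach a} {reach (proj₁ first)} {l} {rank w₀}
        (proj₂ (on-level aw∈)) (proj₂ (on-level (proj₂ first))))

    leaves : List ℕ
    leaves = take k (map proj₁ D)

    leaf⁻ : ∀ {a} → a ∈ leaves → (a , w₀) ∈ D
    leaf⁻ a∈ = let (_ , aw∈ , a≡) = ∈-map⁻ proj₁ (∈-take k a∈)
               in subst (λ a → (a , w₀) ∈ D) (sym a≡) (centred aw∈)

    near? : Decidable (λ u → w₀ < u × rank u ≤ θ)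
    near? u = (w₀ <? u) ×-dec (rank u ≤? θ)

    near far : ℕ → List ℕ
    near a = take k (filter near? (right a))
    far  a = take k (filter (λ u → θ <? rank u) (right a))

    ∈near⁻ : ∀ {a u} → u ∈ near a → (a , u) ∈ E G × w₀ < u × rank u ≤ θ
    ∈near⁻ {a} u∈ = let (u∈right , w₀<u , rank≤θ) = ∈-filter⁻ near? {xs = right a} (∈-take k u∈)
                    in ∈right⁻ u∈right , w₀<u , rank≤θ

    ∈far⁻ : ∀ {a u} → u ∈ far a → (a , u) ∈ E G × θ < rank u
    ∈far⁻ {a} u∈ = let (u∈right , θ<rank) = ∈-filter⁻ (λ u → θ <? rank u) {xs = right a} (∈-take k u∈)
                   in ∈right⁻ u∈right , θ<rank

    layout : Layout k G
    layout = record
      { centre        = w₀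
      ; leaves        = leaves
      ; near          = near
      ; far           = far
      ; leaves-unique = take⁺ k (Unique-map-injectiveOn proj₁ same-leaf (class-unique _))
      ; near-unique   = λ a → take⁺ k (filter⁺ _ (right-unique a))
      ; far-unique    = λ a → take⁺ k (filter⁺ _ (right-unique a))
      ; #leaves       = length-take-≤ k (subst (k ≤_) (sym (length-map proj₁ D)) many)
      ; #near         = λ {a} a∈ →
          let aw∈ = leaf⁻ a∈
              (_ , _ , _ , k≤between) = dense⁻ (proj₂ (∈class⁻ aw∈))
          in length-take-≤ k (subst (λ t → k ≤ between a w₀ t) (threshold≡θ aw∈) k≤between)
      ; #far          = λ {a} a∈ →
          let aw∈ = leaf⁻ a∈
              (aw∈E , labelled) = ∈class⁻ aw∈
              (_ , _ , long , _) = dense⁻ labelled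
          in length-take-≤ k (subst (λ t → k ≤ beyond a t) (threshold≡θ aw∈) (Long.k≤beyond-threshold aw∈E long))
      ; leaf-centre   = λ a∈ → proj₁ (∈class⁻ (leaf⁻ a∈))
      ; leaf-near     = λ _ u∈ → proj₁ (∈near⁻ u∈)
      ; leaf-far      = λ _ u∈ → proj₁ (∈far⁻ u∈)
      ; centre<near   = λ _ u∈ → proj₁ (proj₂ (∈near⁻ u∈))
      ; near<far      = λ _ _ u∈ u′∈ → ≰⇒> λ u′≤u →
                          <⇒≱ (proj₂ (∈far⁻ u′∈)) (≤-trans (rank-mono u′≤u) (proj₂ (proj₂ (∈near⁻ u∈))))
      }
      where
      same-leaf : ∀ {x y} → x ∈ D → y ∈ D → proj₁ x ≡ proj₁ y → x ≡ y
      same-leaf {_ , _} {_ , _} x∈ y∈ a≡a′ = cong₂ _,_ a≡a′ (trans (on-centre x∈) (sym (on-centre y∈)))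

  dense-class-< : ∀ w₀ l → length (class (dense w₀ l)) < k
  dense-class-< w₀ l = ≰⇒> λ many →
    let (H , multiple , G≻H) = Layout⇒≻Multiple simple 1≤k (DenseLayout.layout w₀ l many) in avoids H multiple G≻H

  class-≤ : ∀ l → length (class l) ≤ k
  class-≤ (final a)    = final-class-≤ a
  class-≤ (sparse a l) = sparse-class-≤ a l
  class-≤ (dense w l)  = <⇒≤ (dense-class-< w l)

  labels : ℕ → List Label
  labels L = map final V
          ++ concatMap (λ a → map (λ l → sparse a l) (upTo (suc L))) V
          ++ concatMap (λ w → map (λ l → dense w l) (upTo (suc L))) V

  #labels : ∀ L → length (labels L) ≤ length V + (length V * suc L + length V * suc L)
  #labels L = begin
    length (labels L)
      ≡⟨ length-++ (map final V) ⟩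
    length (map final V) + length (concatMap sparses V ++ concatMap denses V)
      ≡⟨ cong₂ _+_ (length-map final V) (length-++ (concatMap sparses V)) ⟩
    length V + (length (concatMap sparses V) + length (concatMap denses V))
      ≤⟨ +-monoʳ-≤ (length V) (+-mono-≤ (length-concatMap-≤ sparses V λ a → #levels (λ l → sparse a l))
                                        (length-concatMap-≤ denses V λ w → #levels (λ l → dense w l))) ⟩
    length V + (length V * suc L + length V * suc L) ∎
    where
    open ≤-Reasoning
    sparses denses : ℕ → List Label
    sparses a = map (λ l → sparse a l) (upTo (suc L))
    denses w = map (λ l → dense w l) (upTo (suc L))
    #levels : ∀ (f : ℕ → Label) → length (map f (upTo (suc L))) ≤ suc L
    #levels f = ≤-reflexive (trans (length-map f (upTo (suc L))) (length-upTo (suc L)))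

  module _ (N : ℕ) (|V|≤N : length V ≤ N) where

    level< : ∀ {a w} → (a , w) ∈ E G → k ≤ after a w → level a w < suc ⌊log₂ N ⌋
    level< aw∈ long = s≤s (subst (_≤ ⌊log₂ N ⌋) (⌊log₂[2^n]⌋≡n _)
      (⌊log₂⌋-mono-≤ (≤-trans (Long.2^level≤|V| aw∈ long) |V|≤N)))

    labelled∈labels : ∀ {a w l} → (a , w) ∈ E G → Labelled a w l → l ∈ labels ⌊log₂ N ⌋
    labelled∈labels aw∈ (is-final _) =
      ∈-++⁺ˡ (∈-map⁺ final (proj₁ (∈E⇒∈V aw∈)))
    labelled∈labels aw∈ (is-sparse long _) = ∈-++⁺ʳ (map final V) (∈-++⁺ˡ
      (∈-concatMap⁺ _ (Any.map (λ { refl → ∈-map⁺ _ (∈-upTo⁺ (level< aw∈ long)) }) (proj₁ (∈E⇒∈V aw∈)))))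
    labelled∈labels aw∈ (is-dense long _) = ∈-++⁺ʳ (map final V) (∈-++⁺ʳ _
      (∈-concatMap⁺ _ (Any.map (λ { refl → ∈-map⁺ _ (∈-upTo⁺ (level< aw∈ long)) }) (proj₂ (∈E⇒∈V aw∈)))))

    #edges : length G ≤ (N + (N * suc ⌊log₂ N ⌋ + N * suc ⌊log₂ N ⌋)) * k
    #edges = begin
      length G                    ≡⟨ length-map endpoints G ⟨
      length (E G)                ≤⟨ length-≤-fibres _≟ᴸ_ label (labels L) simple
                                       (λ { {a , w} aw∈ → labelled∈labels aw∈ (proj₂ (classify a w)) }) class-≤ ⟩
      length (labels L) * k       ≤⟨ *-monoˡ-≤ k (≤-trans (#labels L) (+-mono-≤ |V|≤N (+-mono-≤ |V|[1+L]≤N[1+L] |V|[1+L]≤N[1+L]))) ⟩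
      (N + (N * suc L + N * suc L)) * k ∎
      where
      open ≤-Reasoning
      L = ⌊log₂ N ⌋
      |V|[1+L]≤N[1+L] = *-monoˡ-≤ (suc L) |V|≤N

[n+2n[1+L]]k<[5k+1]nL : ∀ n L k → 1 ≤ n → 1 ≤ L → (n + (n * suc L + n * suc L)) * k < (5 * k + 1) * n * L
[n+2n[1+L]]k<[5k+1]nL n L k 1≤n 1≤L = begin-strict
  (n + (n * suc L + n * suc L)) * k ≡⟨ expand n L k ⟩
  n * k * (3 + 2 * L)               ≤⟨ *-monoʳ-≤ (n * k) (+-monoˡ-≤ (2 * L) (*-monoʳ-≤ 3 1≤L)) ⟩
  n * k * (3 * L + 2 * L)           ≡⟨ collect n L k ⟩
  5 * k * n * L                     <⟨ m<m+n (5 * k * n * L) (*-mono-≤ 1≤n 1≤L) ⟩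
  5 * k * n * L + n * L             ≡⟨ distribute n L k ⟩
  (5 * k + 1) * n * L               ∎
  where
  open ≤-Reasoning
  expand : ∀ n L k → (n + (n * suc L + n * suc L)) * k ≡ n * k * (3 + 2 * L)
  expand = solve 3 (λ n L k → (n :+ (n :* (con 1 :+ L) :+ n :* (con 1 :+ L))) :* k := n :* k :* (con 3 :+ con 2 :* L)) refl
  collect : ∀ n L k → n * k * (3 * L + 2 * L) ≡ 5 * k * n * L
  collect = solve 3 (λ n L k → n :* k :* (con 3 :* L :+ con 2 :* L) := con 5 :* k :* n :* L) refl
  distribute : ∀ n L k → 5 * k * n * L + n * L ≡ (5 * k + 1) * n * L
  distribute = solve 3 (λ n L k → con 5 :* k :* n :* L :+ n :* L := (con 5 :* k :+ con 1) :* n :* L) refl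

gex-M≪n·log₂n : ∀ k → 1 ≤ k → GexNLogN k
gex-M≪n·log₂n k 1≤k = 5 * k + 1 , 1 , bound
  where
  bound : ∀ n → 1 < n → ∀ G → Simple G → numVertices G ≤ n → AvoidsM k G →
          length G < (5 * k + 1) * n * ⌊log₂ n ⌋
  bound n 1<n G simple |V|≤n avoids =
    ≤-<-trans (EdgeLabelling.#edges 1≤k simple avoids n |V|≤n)
              ([n+2n[1+L]]k<[5k+1]nL n ⌊log₂ n ⌋ k (<⇒≤ 1<n) 1≤⌊log₂n⌋)
    where
    1≤⌊log₂n⌋ : 1 ≤ ⌊log₂ n ⌋
    1≤⌊log₂n⌋ = subst (_≤ ⌊log₂ n ⌋) (⌊log₂[2^n]⌋≡n 1) (⌊log₂⌋-mono-≤ 1<n)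

lemma2 : ((k : ℕ) → 1 ≤ k → ∀ G → Multiple (3 * k + 1) G → InBlowUp k G₁ G)
       × ((k : ℕ) → 1 ≤ k → GexNLogN k)
lemma2 = (λ k _ → Multiple⇒BlowUp k) , gex-M≪n·log₂n
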